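{- Let $t$ be a PPC term and $V,M$ lists of lists of distinct symbols such that $\mathcal T_{V,M}(t)$ is defined (and $\mathcal U_{V,M}$ is defined on the result). Then $\mathcal U_{V,M}(\mathcal T_{V,M}(t))=_\alpha t$.
   Context: **Terms.** PPC terms: $t::=x\mid\hat x\mid t\,t\mid\lambda_\theta p.s$, with $\theta$ a list of symbols binding matchables in $p$ and variables in $s$; $=_\alpha$ is $\alpha$-equivalence. PPC_dB terms: $t::=\mathsf v_{i,j}\mid\mathsf m_{i,j}\mid t\,t\mid\lambda_np.s$. **Translations.** For lists of lists of symbols ($V_i$ is the $i$-th list, $V_{ij}$ its $j$-th element; $\theta++V=[\theta]++V$): Forward translation (defined when the free variables of $t$ occur in $V$ and its free matchables occur in $M$): - $\mathcal T_{V,M}(x)=\mathsf v_{i,j}$ with $i=\min\{i'\mid x\in V_{i'}\}$ and $j=\min\{j'\mid x=V_{ij'}\}$; - $\mathcal T_{V,M}(\hat x)=\mathsf m_{i,j}$, likewise using $M$; - homomorphic on applications; - $\mathcal T_{V,M}(\lambda_\theta p.s)=\lambda_{|\theta|}\mathcal T_{V,\theta++M}(p).\mathcal T_{\theta++V,M}(s)$. Backward translation: - $\mathcal U_{V,M}(\mathsf v_{i,j})=V_{ij}$ and $\mathcal U_{V,M}(\mathsf m_{i,j})=\widehat{M_{ij}}$; - homomorphic on applications; - $\mathcal U_{V,M}(\lambda_np.s)=\lambda_\theta\mathcal U_{V,\theta++M}(p).\mathcal U_{\theta++V,M}(s)$, with $\theta$ a list of $n$ fresh symbols. -}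

module Defs where

open import Data.Nat using (ℕ; zero; suc; _≟_)
open import Data.Product using (_×_; _,_)
open import Data.List using (List; []; _∷_; length; concat)
open import Data.List.Membership.Propositional using (_∉_)
open import Data.List.Relation.Unary.All using (All)
open import Data.List.Relation.Unary.Unique.Propositional using (Unique)
open import Data.Maybe using (Maybe; just; nothing)
open import Relation.Nullary using (yes; no)
open import Relation.Binary.PropositionalEquality using (_≡_)

-- Symbols: an infinite set with decidable equality; we take ℕ.
Sym : Set
Sym = ℕ

data Term : Set where
  var : Sym → Term
  mat : Sym → Term
  app : Term → Term → Term
  lam : List Sym → Term → Term → Term   -- lam θ p s  =  λ_θ p . s

data DTerm : Set where
  dv   : ℕ → ℕ → DTerm
  dm   : ℕ → ℕ → DTerm
  dapp : DTerm → DTerm → DTerm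
  dlam : ℕ → DTerm → DTerm → DTerm

index : Sym → List Sym → Maybe ℕ
index x [] = nothing
index x (y ∷ ys) with x ≟ y
... | yes _ = just zero
... | no _ with index x ys
...   | just j  = just (suc j)
...   | nothing = nothing

lookup2 : Sym → List (List Sym) → Maybe (ℕ × ℕ)
lookup2 x [] = nothing
lookup2 x (θ ∷ Γ) with index x θ
... | just j = just (zero , j)
... | nothing with lookup2 x Γ
...   | just (i , j) = just (suc i , j)
...   | nothing      = nothing

nth : {A : Set} → List A → ℕ → Maybe A
nth [] _ = nothing
nth (a ∷ as) zero = just a
nth (a ∷ as) (suc n) = nth as n

nth2 : List (List Sym) → ℕ → ℕ → Maybe Sym
nth2 Γ i j with nth Γ i
... | just θ = nth θ j
... | nothing = nothing

T : List (List Sym) → List (List Sym) → Term → Maybe DTerm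
T V M (var x) with lookup2 x V
... | just (i , j) = just (dv i j)
... | nothing = nothing
T V M (mat x) with lookup2 x M
... | just (i , j) = just (dm i j)
... | nothing = nothing
T V M (app t u) with T V M t | T V M u
... | just a | just b = just (dapp a b)
... | _ | _ = nothing
T V M (lam θ p s) with T V (θ ∷ M) p | T (θ ∷ V) M s
... | just p' | just s' = just (dlam (length θ) p' s')
... | _ | _ = nothing

-- Backward translation U_{V,M}, as a relation:  U V M d u  means that
-- u is a result of U_{V,M}(d) for some admissible choice of fresh
-- symbols at each abstraction (θ: n distinct symbols not occurring in
-- V nor in M).

Fresh : List (List Sym) → List (List Sym) → List Sym → Set
Fresh V M θ = Unique θ × All (λ x → x ∉ concat V × x ∉ concat M) θ

data U : List (List Sym) → List (List Sym) → DTerm → Term → Set where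
  uv   : ∀ {V M i j x} → nth2 V i j ≡ just x → U V M (dv i j) (var x)
  um   : ∀ {V M i j x} → nth2 M i j ≡ just x → U V M (dm i j) (mat x)
  uapp : ∀ {V M a b t u} → U V M a t → U V M b u → U V M (dapp a b) (app t u)
  ulam : ∀ {V M n p s θ p' s'} →
         length θ ≡ n → Fresh V M θ →
         U V (θ ∷ M) p p' → U (θ ∷ V) M s s' →
         U V M (dlam n p s) (lam θ p' s')

-- Two symbol occurrences correspond under binder stacks
-- Γ, Γ' (innermost first) iff both are bound by the same (innermost)
-- binder at the same position, or both are free and equal.

data Corr : List (List Sym) → List (List Sym) → Sym → Sym → Set where
  free  : ∀ {x} → Corr [] [] x x
  here  : ∀ {θ θ' Γ Γ' x y j} → index x θ ≡ just j → index y θ' ≡ just j →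
          Corr (θ ∷ Γ) (θ' ∷ Γ') x y
  there : ∀ {θ θ' Γ Γ' x y} → index x θ ≡ nothing → index y θ' ≡ nothing →
          Corr Γ Γ' x y → Corr (θ ∷ Γ) (θ' ∷ Γ') x y

-- Alpha ΓV ΓV' ΓM ΓM' t t' : t and t' are α-equivalent, where ΓV/ΓV'
-- are the enclosing binders for variables and ΓM/ΓM' for matchables.
-- In λ_θ p.s, θ binds the matchables of p and the variables of s.
data Alpha : List (List Sym) → List (List Sym) → List (List Sym) → List (List Sym) →
             Term → Term → Set where
  avar : ∀ {ΓV ΓV' ΓM ΓM' x y} → Corr ΓV ΓV' x y → Alpha ΓV ΓV' ΓM ΓM' (var x) (var y)
  amat : ∀ {ΓV ΓV' ΓM ΓM' x y} → Corr ΓM ΓM' x y → Alpha ΓV ΓV' ΓM ΓM' (mat x) (mat y)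
  aapp : ∀ {ΓV ΓV' ΓM ΓM' t u t' u'} →
         Alpha ΓV ΓV' ΓM ΓM' t t' → Alpha ΓV ΓV' ΓM ΓM' u u' →
         Alpha ΓV ΓV' ΓM ΓM' (app t u) (app t' u')
  alam : ∀ {ΓV ΓV' ΓM ΓM' θ θ' p s p' s'} →
         length θ ≡ length θ' →
         Alpha ΓV ΓV' (θ ∷ ΓM) (θ' ∷ ΓM') p p' →
         Alpha (θ ∷ ΓV) (θ' ∷ ΓV') ΓM ΓM' s s' →
         Alpha ΓV ΓV' ΓM ΓM' (lam θ p s) (lam θ' p' s')

infix 4 _=α_
_=α_ : Term → Term → Set
t =α t' = Alpha [] [] [] [] t t'

module Submission where

-- U ∘ T is the identity up to α-renaming of binders: T replaces
-- every occurrence by the (i , j) address of its innermost binding list, and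
-- U reads the address back in a stack where each original binder list θ has
-- been replaced by a fresh list θ' of the same length.  We prove this for an
-- arbitrary term under a binder stack Γ (original) / Γ' (fresh) sitting on
-- top of a common outer context V, which is the generality the induction
-- through λ_θ needs; the theorem is the case of empty stacks.
--
-- The uniqueness hypotheses on V and M turn out not to be needed: a free
-- symbol is read back at the very address at which it was found.

open import Defs
open import Data.List using (List; []; _∷_; _++_; concat; length)
open import Data.List.Relation.Unary.All using (All; []; _∷_)
import Data.List.Relation.Unary.All as All
open import Data.List.Relation.Unary.AllPairs using (_∷_)
open import Data.List.Relation.Unary.Unique.Propositional using (Unique)
open import Data.List.Relation.Unary.Any using (here; there)
open import Data.List.Membership.Propositional using (_∈_; _∉_)
open import Data.List.Membership.Propositional.Properties using (∈-++⁺ˡ; ∈-++⁺ʳ)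
open import Data.Maybe using (just; nothing)
open import Data.Maybe.Properties using (just-injective)
open import Data.Nat using (zero; suc; _≟_)
open import Data.Product using (_×_; _,_; proj₁; proj₂; ∃₂)
open import Data.Empty using (⊥-elim)
open import Relation.Nullary using (yes; no)
open import Relation.Binary.PropositionalEquality using (_≡_; refl; sym; trans)

nth-∈ : ∀ {θ : List Sym} {j x} → nth θ j ≡ just x → x ∈ θ
nth-∈ {y ∷ ys} {zero}  eq with just-injective eq
... | refl = here refl
nth-∈ {y ∷ ys} {suc j} eq = there (nth-∈ {ys} eq)

index-nth : ∀ {x} {θ : List Sym} {j} → index x θ ≡ just j → nth θ j ≡ just x
index-nth {x} {y ∷ ys} eq with x ≟ y
index-nth {x} {y ∷ ys} refl | yes refl = refl
index-nth {x} {y ∷ ys} eq   | no _ with index x ys in e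
index-nth {x} {y ∷ ys} refl | no _ | just j = index-nth {x} {ys} e
index-nth {x} {y ∷ ys} ()   | no _ | nothing

index-unique : ∀ {θ : List Sym} {j x} → Unique θ → nth θ j ≡ just x → index x θ ≡ just j
index-unique {y ∷ ys} {zero} {x} _ eq with just-injective eq
... | refl with x ≟ x
...   | yes _  = refl
...   | no x≢x = ⊥-elim (x≢x refl)
index-unique {y ∷ ys} {suc j} {x} (y∉ys ∷ u) eq with x ≟ y
... | yes refl = ⊥-elim (All.lookup y∉ys (nth-∈ {ys} eq) refl)
... | no _ rewrite index-unique {ys} u eq = refl

index-fresh : ∀ {L θ : List Sym} {x} → All (_∉ L) θ → x ∈ L → index x θ ≡ nothing
index-fresh {θ = []}     []          _   = refl
index-fresh {θ = y ∷ ys} {x} (y∉L ∷ fr) x∈L with x ≟ y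
... | yes refl = ⊥-elim (y∉L x∈L)
... | no _ rewrite index-fresh fr x∈L = refl

nth2-suc : ∀ (θ : List Sym) Γ i j → nth2 (θ ∷ Γ) (suc i) j ≡ nth2 Γ i j
nth2-suc θ Γ i j with nth Γ i
... | just _  = refl
... | nothing = refl

nth2-∈ : ∀ {Γ : List (List Sym)} {i j x} → nth2 Γ i j ≡ just x → x ∈ concat Γ
nth2-∈ {θ ∷ Γ} {zero}      eq = ∈-++⁺ˡ (nth-∈ {θ} eq)
nth2-∈ {θ ∷ Γ} {suc i} {j} eq = ∈-++⁺ʳ θ (nth2-∈ {Γ} (trans (sym (nth2-suc θ Γ i j)) eq))

lookup2-nth2 : ∀ {Γ : List (List Sym)} {x i j} → lookup2 x Γ ≡ just (i , j) → nth2 Γ i j ≡ just x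
lookup2-nth2 {θ ∷ Γ} {x} eq with index x θ in e
lookup2-nth2 {θ ∷ Γ} {x} refl | just j  = index-nth {x} {θ} e
lookup2-nth2 {θ ∷ Γ} {x} eq   | nothing with lookup2 x Γ in e′
lookup2-nth2 {θ ∷ Γ} {x} refl | nothing | just (i , j) =
  trans (nth2-suc θ Γ i j) (lookup2-nth2 {Γ} e′)
lookup2-nth2 {θ ∷ Γ} {x} ()   | nothing | nothing

-- FreshStack Γ' Γ V: the stacks Γ' (chosen by U) and Γ (of the original
-- term) have equal height, and every list θ' of Γ' is duplicate-free and
-- fresh for all lists below it in Γ' ++ V — exactly what U's Fresh provides.
data FreshStack : List (List Sym) → List (List Sym) → List (List Sym) → Set where
  base : ∀ {V} → FreshStack [] [] V
  push : ∀ {Γ' Γ V θ' θ} → FreshStack Γ' Γ V → Unique θ' →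
         All (_∉ concat (Γ' ++ V)) θ' → FreshStack (θ' ∷ Γ') (θ ∷ Γ) V

-- Freshness guarantees x is not captured by an outer list θ'.
address-corr : ∀ {Γ' Γ V x y i j} → FreshStack Γ' Γ V →
               lookup2 y (Γ ++ V) ≡ just (i , j) → nth2 (Γ' ++ V) i j ≡ just x →
               Corr Γ' Γ x y
address-corr {V = V} base found read with trans (sym read) (lookup2-nth2 {V} found)
... | refl = free
address-corr {θ' ∷ Γ'} {θ ∷ Γ} {V} {y = y} (push stack u fr) found read with index y θ in e
address-corr {θ' ∷ Γ'} {θ ∷ Γ} {V} {y = y} (push stack u fr) refl read | just j =
  here (index-unique {θ'} u read) e
... | nothing with lookup2 y (Γ ++ V) in e′
address-corr {θ' ∷ Γ'} {θ ∷ Γ} {V} {y = y} (push stack u fr) refl read | nothing | just (i , j) =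
  there (index-fresh fr (nth2-∈ {Γ' ++ V} read′)) e (address-corr stack e′ read′)
  where read′ = trans (sym (nth2-suc θ' (Γ' ++ V) i j)) read
address-corr (push _ _ _) () _ | nothing | nothing

T-var-inv : ∀ V M x {d} → T V M (var x) ≡ just d →
            ∃₂ λ i j → lookup2 x V ≡ just (i , j) × d ≡ dv i j
T-var-inv V M x eq with lookup2 x V
T-var-inv V M x refl | just (i , j) = i , j , refl , refl
T-var-inv V M x ()   | nothing

T-mat-inv : ∀ V M x {d} → T V M (mat x) ≡ just d →
            ∃₂ λ i j → lookup2 x M ≡ just (i , j) × d ≡ dm i j
T-mat-inv V M x eq with lookup2 x M
T-mat-inv V M x refl | just (i , j) = i , j , refl , refl
T-mat-inv V M x ()   | nothing

T-app-inv : ∀ V M t u {d} → T V M (app t u) ≡ just d →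
            ∃₂ λ a b → T V M t ≡ just a × T V M u ≡ just b × d ≡ dapp a b
T-app-inv V M t u eq with T V M t | T V M u
T-app-inv V M t u refl | just a  | just b  = a , b , refl , refl , refl
T-app-inv V M t u ()   | just _  | nothing
T-app-inv V M t u ()   | nothing | _

T-lam-inv : ∀ V M θ p s {d} → T V M (lam θ p s) ≡ just d →
            ∃₂ λ a b → T V (θ ∷ M) p ≡ just a × T (θ ∷ V) M s ≡ just b ×
                       d ≡ dlam (length θ) a b
T-lam-inv V M θ p s eq with T V (θ ∷ M) p | T (θ ∷ V) M s
T-lam-inv V M θ p s refl | just a  | just b  = a , b , refl , refl , refl
T-lam-inv V M θ p s ()   | just _  | nothing
T-lam-inv V M θ p s ()   | nothing | _

-- At a λ_θ, U's
-- fresh θ' is pushed on the matchable stack for p and the variable stack for s.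
round-trip : ∀ t {Γ'V ΓV V Γ'M ΓM M d u} →
             FreshStack Γ'V ΓV V → FreshStack Γ'M ΓM M →
             T (ΓV ++ V) (ΓM ++ M) t ≡ just d → U (Γ'V ++ V) (Γ'M ++ M) d u →
             Alpha Γ'V ΓV Γ'M ΓM u t
round-trip (var x) {ΓV = ΓV} {V} {ΓM = ΓM} {M} sV sM eq u
  with T-var-inv (ΓV ++ V) (ΓM ++ M) x eq
round-trip (var x) sV sM eq (uv read) | _ , _ , found , refl = avar (address-corr sV found read)
round-trip (mat x) {ΓV = ΓV} {V} {ΓM = ΓM} {M} sV sM eq u
  with T-mat-inv (ΓV ++ V) (ΓM ++ M) x eq
round-trip (mat x) sV sM eq (um read) | _ , _ , found , refl = amat (address-corr sM found read)
round-trip (app t t′) {ΓV = ΓV} {V} {ΓM = ΓM} {M} sV sM eq u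
  with T-app-inv (ΓV ++ V) (ΓM ++ M) t t′ eq
round-trip (app t t′) sV sM eq (uapp ut ut′) | _ , _ , et , et′ , refl =
  aapp (round-trip t sV sM et ut) (round-trip t′ sV sM et′ ut′)
round-trip (lam θ p s) {ΓV = ΓV} {V} {ΓM = ΓM} {M} sV sM eq u
  with T-lam-inv (ΓV ++ V) (ΓM ++ M) θ p s eq
round-trip (lam θ p s) sV sM eq (ulam len (uniq , fresh) up us) | _ , _ , ep , es , refl =
  alam len (round-trip p sV (push sM uniq (All.map proj₂ fresh)) ep up)
           (round-trip s (push sV uniq (All.map proj₁ fresh)) sM es us)

lemma4p12 : (t : Term) (V M : List (List Sym)) (d : DTerm) (u : Term) →
            All Unique V → All Unique M →
            T V M t ≡ just d → U V M d u → u =α t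
lemma4p12 t V M d u _ _ translate readBack = round-trip t base base translate readBack
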